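{- Let $K$ be an algebraically closed field of characteristic not $2$, fix a positive integer $N$ and $a\in K$. The following are equivalent: (a) $P_{N,a}$ is nonsingular; (b) $P_{M,a}$ is nonsingular for all $1\le M\le N$; (c) there do not exist an integer $j$ with $2\le j\le N$ and $c_0\in K$ such that $f_{c_0}^j(0)=a$ and $\frac{\partial f_c^j(0)}{\partial c}\big|_{c=c_0}=0$.
   Context: $f_c(x)=x^2+c$, $f_c^N$ its $N$-th iterate, viewed with $c$ an indeterminate as a polynomial in $K[x,c]$. For $a\in K$, $P_{N,a}\subset\mathbb{A}^2$ (coordinates $(x,c)$) is the algebraic set defined by $f_c^N(x)-a=0$. -}

module Defs where

open import Level using (Level; _⊔_; suc)
open import Data.Nat using (ℕ; zero; suc; _≤_)
open import Data.List using (List; []; _∷_)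
open import Data.Product using (Σ; ∃; _×_; _,_)
open import Data.Empty using (⊥)
open import Relation.Nullary using (¬_)
open import Algebra.Bundles using (CommutativeRing)

record Field (c ℓ : Level) : Set (Level.suc (c ⊔ ℓ)) where
  field
    commutativeRing : CommutativeRing c ℓ
  open CommutativeRing commutativeRing public
  field
    1≉0     : ¬ (1# ≈ 0#)
    inverse : ∀ x → ¬ (x ≈ 0#) → ∃ λ y → x * y ≈ 1#

-- Evaluation of the monic polynomial  x^n + a_{n-1} x^{n-1} + ... + a_0
-- where the coefficient list is [a_0, ..., a_{n-1}] (Horner scheme).
module _ {c ℓ} (K : Field c ℓ) where
  open Field K
  evalMonic : List Carrier → Carrier → Carrier
  evalMonic []       x = 1#
  evalMonic (a ∷ as) x = a + x * evalMonic as x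

record AlgClosedField (c ℓ : Level) : Set (Level.suc (c ⊔ ℓ)) where
  field
    fld : Field c ℓ
  open Field fld public
  field
    algClosed : ∀ (a : Carrier) (as : List Carrier) →
                ∃ λ x → evalMonic fld (a ∷ as) x ≈ 0#

CharNot2 : ∀ {c ℓ} → AlgClosedField c ℓ → Set ℓ
CharNot2 K = ¬ (1# + 1# ≈ 0#) where open AlgClosedField K

data PolyExpr {a} (A : Set a) : Set a where
  varX  : PolyExpr A
  varC  : PolyExpr A
  const : A → PolyExpr A
  _⊕_   : PolyExpr A → PolyExpr A → PolyExpr A
  _⊗_   : PolyExpr A → PolyExpr A → PolyExpr A

module PolyOps {c ℓ} (K : AlgClosedField c ℓ) where
  open AlgClosedField K

  eval : PolyExpr Carrier → Carrier → Carrier → Carrier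
  eval varX      x c = x
  eval varC      x c = c
  eval (const k) x c = k
  eval (p ⊕ q)   x c = eval p x c + eval q x c
  eval (p ⊗ q)   x c = eval p x c * eval q x c

  ∂x : PolyExpr Carrier → PolyExpr Carrier
  ∂x varX      = const 1#
  ∂x varC      = const 0#
  ∂x (const k) = const 0#
  ∂x (p ⊕ q)   = ∂x p ⊕ ∂x q
  ∂x (p ⊗ q)   = (∂x p ⊗ q) ⊕ (p ⊗ ∂x q)

  ∂c : PolyExpr Carrier → PolyExpr Carrier
  ∂c varX      = const 0#
  ∂c varC      = const 1#
  ∂c (const k) = const 0#
  ∂c (p ⊕ q)   = ∂c p ⊕ ∂c q
  ∂c (p ⊗ q)   = (∂c p ⊗ q) ⊕ (p ⊗ ∂c q)

  fc : PolyExpr Carrier → PolyExpr Carrier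
  fc e = (e ⊗ e) ⊕ varC

  iter : ℕ → PolyExpr Carrier → PolyExpr Carrier
  iter zero    e = e
  iter (suc n) e = fc (iter n e)

  Pol : ℕ → Carrier → PolyExpr Carrier
  Pol N a = iter N varX ⊕ const (- a)

  -- P_{N,a} = V(f_c^N(x) - a) ⊂ 𝔸² is nonsingular: no point of it where
  -- both partial derivatives vanish.
  Nonsingular : ℕ → Carrier → Set (c ⊔ ℓ)
  Nonsingular N a = ∀ (x c₀ : Carrier) →
    eval (Pol N a) x c₀ ≈ 0# →
    eval (∂x (Pol N a)) x c₀ ≈ 0# →
    eval (∂c (Pol N a)) x c₀ ≈ 0# → ⊥

  CondC : ℕ → Carrier → Set (c ⊔ ℓ)
  CondC N a = ¬ (Σ ℕ λ j → 2 ≤ j × j ≤ N × Σ Carrier λ c₀ →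
      (eval (iter j (const 0#)) 0# c₀ ≈ a) ×
      (eval (∂c (iter j (const 0#))) 0# c₀ ≈ 0#))

{-# OPTIONS --safe #-}
-- Write V_n = f_c^n(x).  Since ∂V_{n+1}/∂x = 2 V_n ∂V_n/∂x, the derivative
-- ∂V_N/∂x is 2^N V_0 ⋯ V_{N-1}, so a singular point of P_{N,a} has V_i = 0 for
-- some i < N.  From such a point the orbit restarts at the critical point 0:
-- V_{j+i} and ∂V_{j+i}/∂c agree with f_c^j(0) and ∂f_c^j(0)/∂c for j ≥ 1, so
-- the singular point yields a pair (j , c₀) as in (c); j = 1 is impossible
-- because ∂f_c(0)/∂c = 1.  Conversely such a pair, together with a root x of
-- V_{N-j}(·, c₀) (which exists by algebraic closedness), is a singular point.
-- Condition (c) is visibly monotone in N, which gives (b).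
module Submission where

open import Defs
open import Data.Nat using (ℕ; zero; suc; _≤_; _<_; s≤s; z≤n) renaming (_+_ to _+ℕ_)
open import Data.Nat.Properties using (≤-refl; ≤-trans; m≤m+n; n<1+n; m<n⇒m<1+n; m≤n⇒∃[o]m+o≡n)
  renaming (+-comm to +ℕ-comm)
open import Data.Product using (_×_; _,_; ∃)
open import Data.List using ([]; _∷_)
open import Function.Bundles using (_⇔_; mk⇔)
open import Relation.Binary.PropositionalEquality as ≡ using (_≡_)
import Algebra.Properties.Ring as RingProperties
import Relation.Binary.Reasoning.Setoid as SetoidReasoning

<⇒∃[o]suc-o+m≡n : ∀ {m n} → m < n → ∃ λ o → suc o +ℕ m ≡ n
<⇒∃[o]suc-o+m≡n {m} m<n with m≤n⇒∃[o]m+o≡n m<n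
... | o , ≡.refl = o , ≡.cong suc (+ℕ-comm o m)

module _ {c ℓ} (F : Field c ℓ) where
  open Field F
  open SetoidReasoning setoid

  x≉0∧y≉0⇒x*y≉0 : ∀ {x y} → x ≉ 0# → y ≉ 0# → x * y ≉ 0#
  x≉0∧y≉0⇒x*y≉0 {x} {y} x≉0 y≉0 xy≈0 with inverse x x≉0 | inverse y y≉0
  ... | x⁻¹ , xx⁻¹≈1 | y⁻¹ , yy⁻¹≈1 = 1≉0 (begin
    1#                        ≈⟨ *-identityʳ 1# ⟨
    1# * 1#                   ≈⟨ *-cong xx⁻¹≈1 yy⁻¹≈1 ⟨
    (x * x⁻¹) * (y * y⁻¹)     ≈⟨ *-congˡ (*-comm y y⁻¹) ⟩
    (x * x⁻¹) * (y⁻¹ * y)     ≈⟨ *-assoc x x⁻¹ (y⁻¹ * y) ⟩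
    x * (x⁻¹ * (y⁻¹ * y))     ≈⟨ *-congˡ (*-assoc x⁻¹ y⁻¹ y) ⟨
    x * ((x⁻¹ * y⁻¹) * y)     ≈⟨ *-congˡ (*-comm (x⁻¹ * y⁻¹) y) ⟩
    x * (y * (x⁻¹ * y⁻¹))     ≈⟨ *-assoc x y (x⁻¹ * y⁻¹) ⟨
    (x * y) * (x⁻¹ * y⁻¹)     ≈⟨ *-congʳ xy≈0 ⟩
    0# * (x⁻¹ * y⁻¹)          ≈⟨ zeroˡ (x⁻¹ * y⁻¹) ⟩
    0#                        ∎)

  x*y+y*x≈[1+1]*[x*y] : ∀ x y → x * y + y * x ≈ (1# + 1#) * (x * y)
  x*y+y*x≈[1+1]*[x*y] x y = begin
    x * y + y * x               ≈⟨ +-cong (*-identityˡ (x * y)) (trans (*-identityˡ (x * y)) (*-comm x y)) ⟨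
    1# * (x * y) + 1# * (x * y) ≈⟨ distribʳ (x * y) 1# 1# ⟨
    (1# + 1#) * (x * y)         ∎

  y≈0⇒x*y+y*x≈0 : ∀ {x y} → y ≈ 0# → x * y + y * x ≈ 0#
  y≈0⇒x*y+y*x≈0 {x} {y} y≈0 = begin
    x * y + y * x   ≈⟨ +-cong (*-congˡ y≈0) (*-congʳ y≈0) ⟩
    x * 0# + 0# * x ≈⟨ +-cong (zeroʳ x) (zeroˡ x) ⟩
    0# + 0#         ≈⟨ +-identityʳ 0# ⟩
    0#              ∎

module _ {c ℓ} (K : AlgClosedField c ℓ) where
  open AlgClosedField K
  open PolyOps K
  open RingProperties ring using (x∙y⁻¹≈ε⇒x≈y; x≈y⇒x∙y⁻¹≈ε)
  open SetoidReasoning setoid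

  private
    Expr : Set c
    Expr = PolyExpr Carrier

  √-exists : ∀ y → ∃ λ x → x * x ≈ y
  √-exists y with algClosed (- y) (0# ∷ [])
  ... | x , -y+x[0+x1]≈0 = x , x∙y⁻¹≈ε⇒x≈y (x * x) y (begin
    x * x + - y              ≈⟨ +-comm (x * x) (- y) ⟩
    - y + x * x              ≈⟨ +-congˡ (*-congˡ (trans (+-identityˡ (x * 1#)) (*-identityʳ x))) ⟨
    - y + x * (0# + x * 1#)  ≈⟨ -y+x[0+x1]≈0 ⟩
    0#                       ∎)

  fc-preimage : ∀ y c₀ → ∃ λ x → x * x + c₀ ≈ y
  fc-preimage y c₀ with √-exists (y + - c₀)
  ... | x , x²≈y-c₀ = x , (begin
    x * x + c₀          ≈⟨ +-congʳ x²≈y-c₀ ⟩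
    (y + - c₀) + c₀     ≈⟨ +-assoc y (- c₀) c₀ ⟩
    y + (- c₀ + c₀)     ≈⟨ +-congˡ (-‿inverseˡ c₀) ⟩
    y + 0#              ≈⟨ +-identityʳ y ⟩
    y                   ∎)

  iter-suc-fc : ∀ n (e : Expr) → iter (suc n) e ≡ iter n (fc e)
  iter-suc-fc zero    e = ≡.refl
  iter-suc-fc (suc n) e = ≡.cong fc (iter-suc-fc n e)

  iter-resp-eval : ∀ n {e e′ : Expr} {x x′ c₀} → eval e x c₀ ≈ eval e′ x′ c₀ →
                   eval (iter n e) x c₀ ≈ eval (iter n e′) x′ c₀
  iter-resp-eval zero    e≈e′ = e≈e′
  iter-resp-eval (suc n) {e} {e′} {x} {x′} {c₀} e≈e′ = +-congʳ (*-cong ih ih)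
    where
    ih : eval (iter n e) x c₀ ≈ eval (iter n e′) x′ c₀
    ih = iter-resp-eval n e≈e′

  iter-root : ∀ n c₀ → ∃ λ x → eval (iter n varX) x c₀ ≈ 0#
  iter-root zero    c₀ = 0# , refl
  iter-root (suc n) c₀ with iter-root n c₀
  ... | y , Vₙ[y]≈0 with fc-preimage y c₀
  ... | x , fx≈y = x , (begin
    eval (iter (suc n) varX) x c₀    ≡⟨ ≡.cong (λ e → eval e x c₀) (iter-suc-fc n varX) ⟩
    eval (iter n (fc varX)) x c₀     ≈⟨ iter-resp-eval n fx≈y ⟩
    eval (iter n varX) y c₀          ≈⟨ Vₙ[y]≈0 ⟩
    0#                               ∎)

  record SameCJet (e : Expr) (x : Carrier) (e′ : Expr) (x′ c₀ : Carrier) : Set ℓ where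
    constructor _,_
    field
      value≈ : eval e x c₀ ≈ eval e′ x′ c₀
      ∂c≈    : eval (∂c e) x c₀ ≈ eval (∂c e′) x′ c₀

  fc-resp-SameCJet : ∀ {e e′ x x′ c₀} → SameCJet e x e′ x′ c₀ → SameCJet (fc e) x (fc e′) x′ c₀
  fc-resp-SameCJet (v≈v′ , d≈d′) =
    +-congʳ (*-cong v≈v′ v≈v′) , +-congʳ (+-cong (*-cong d≈d′ v≈v′) (*-cong v≈v′ d≈d′))

  -- At a root of e the c-derivative of e is multiplied by 0 in ∂(e² + c)/∂c.
  fc-resp-root : ∀ {e e′ x x′ c₀} → eval e x c₀ ≈ 0# → eval e′ x′ c₀ ≈ 0# →
                 SameCJet (fc e) x (fc e′) x′ c₀
  fc-resp-root {e} {e′} {x} {x′} {c₀} v≈0 v′≈0 =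
    +-congʳ (*-cong v≈v′ v≈v′) ,
    +-congʳ (trans (y≈0⇒x*y+y*x≈0 fld v≈0) (sym (y≈0⇒x*y+y*x≈0 fld v′≈0)))
    where
    v≈v′ : eval e x c₀ ≈ eval e′ x′ c₀
    v≈v′ = trans v≈0 (sym v′≈0)

  restart-at-root : ∀ i e {x c₀} → eval (iter i e) x c₀ ≈ 0# → ∀ k →
                    SameCJet (iter (suc k +ℕ i) e) x (iter (suc k) (const 0#)) 0# c₀
  restart-at-root i e v≈0 zero    = fc-resp-root v≈0 refl
  restart-at-root i e v≈0 (suc k) = fc-resp-SameCJet (restart-at-root i e v≈0 k)

  ∂x-iter-root : ∀ i e {x c₀} → eval (iter i e) x c₀ ≈ 0# → ∀ k →
                 eval (∂x (iter (suc k +ℕ i) e)) x c₀ ≈ 0#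
  ∂x-iter-root i e v≈0 zero    = trans (+-identityʳ _) (y≈0⇒x*y+y*x≈0 fld v≈0)
  ∂x-iter-root i e v≈0 (suc k) =
    trans (+-identityʳ _) (trans (+-comm _ _) (y≈0⇒x*y+y*x≈0 fld (∂x-iter-root i e v≈0 k)))

  ∂x-iter-≉0 : 1# + 1# ≉ 0# → ∀ n {e x c₀} → (∀ i → i < n → eval (iter i e) x c₀ ≉ 0#) →
               eval (∂x e) x c₀ ≉ 0# → eval (∂x (iter n e)) x c₀ ≉ 0#
  ∂x-iter-≉0 2≉0 zero    _        ∂e≉0 = ∂e≉0
  ∂x-iter-≉0 2≉0 (suc n) {e} {x} {c₀} Vᵢ≉0 ∂e≉0 ∂≈0 =
    x≉0∧y≉0⇒x*y≉0 fld 2≉0 (x≉0∧y≉0⇒x*y≉0 fld ∂ₙ≉0 (Vᵢ≉0 n (n<1+n n)))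
      (trans (sym (x*y+y*x≈[1+1]*[x*y] fld _ _)) (trans (sym (+-identityʳ _)) ∂≈0))
    where
    ∂ₙ≉0 : eval (∂x (iter n e)) x c₀ ≉ 0#
    ∂ₙ≉0 = ∂x-iter-≉0 2≉0 n (λ i i<n → Vᵢ≉0 i (m<n⇒m<1+n i<n)) ∂e≉0

  ∂c-iter-1 : ∀ c₀ → eval (∂c (iter 1 (const 0#))) 0# c₀ ≈ 1#
  ∂c-iter-1 c₀ = trans (+-congʳ (y≈0⇒x*y+y*x≈0 fld refl)) (+-identityˡ 1#)

  CondC-antimono : ∀ {M N a} → M ≤ N → CondC N a → CondC M a
  CondC-antimono M≤N ¬c (j , 2≤j , j≤M , rest) = ¬c (j , 2≤j , ≤-trans j≤M M≤N , rest)

  nonsingular⇒CondC : ∀ N a → Nonsingular N a → CondC N a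
  nonsingular⇒CondC N a ns (zero , () , _)
  nonsingular⇒CondC N a ns (suc zero , s≤s () , _)
  nonsingular⇒CondC N a ns (suc (suc k) , _ , j≤N , c₀ , fʲ0≈a , ∂fʲ0≈0)
    with m≤n⇒∃[o]m+o≡n j≤N
  ... | i , ≡.refl with iter-root i c₀
  ... | x , Vᵢ≈0 with restart-at-root i varX Vᵢ≈0 (suc k)
  ... | V≈fʲ0 , ∂V≈∂fʲ0 =
    ns x c₀ (x≈y⇒x∙y⁻¹≈ε (trans V≈fʲ0 fʲ0≈a))
            (trans (+-identityʳ _) (∂x-iter-root i varX Vᵢ≈0 (suc k)))
            (trans (+-identityʳ _) (trans ∂V≈∂fʲ0 ∂fʲ0≈0))

  CondC⇒nonsingular : CharNot2 K → ∀ N a → CondC N a → Nonsingular N a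
  CondC⇒nonsingular 2≉0 N a ¬c x c₀ V≈a ∂xV≈0 ∂cV≈0 =
    ∂x-iter-≉0 2≉0 N Vᵢ≉0 1≉0 (trans (sym (+-identityʳ _)) ∂xV≈0)
    where
    Vᵢ≉0 : ∀ i → i < N → eval (iter i varX) x c₀ ≉ 0#
    Vᵢ≉0 i i<N Vᵢ≈0 with <⇒∃[o]suc-o+m≡n i<N
    ... | k , ≡.refl with restart-at-root i varX Vᵢ≈0 k
    ... | V≈fʲ0 , ∂V≈∂fʲ0 with k
    ... | zero  = 1≉0 (trans (sym (∂c-iter-1 c₀)) (trans (sym ∂V≈∂fʲ0) ∂V≈0))
      where
      ∂V≈0 : eval (∂c (iter (1 +ℕ i) varX)) x c₀ ≈ 0#
      ∂V≈0 = trans (sym (+-identityʳ _)) ∂cV≈0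
    ... | suc m = ¬c (suc (suc m) , s≤s (s≤s z≤n) , m≤m+n (suc (suc m)) i , c₀ ,
                      trans (sym V≈fʲ0) (x∙y⁻¹≈ε⇒x≈y _ _ V≈a) ,
                      trans (sym ∂V≈∂fʲ0) (trans (sym (+-identityʳ _)) ∂cV≈0))

proposition2p1 : ∀ {c ℓ} (K : AlgClosedField c ℓ) → CharNot2 K →
    (N : ℕ) → 1 ≤ N → (a : AlgClosedField.Carrier K) →
    ((PolyOps.Nonsingular K N a ⇔ (∀ (M : ℕ) → 1 ≤ M → M ≤ N → PolyOps.Nonsingular K M a))
    × (PolyOps.Nonsingular K N a ⇔ PolyOps.CondC K N a))
proposition2p1 K 2≉0 N 1≤N a =
  mk⇔ (λ ns M _ M≤N → CondC⇒nonsingular K 2≉0 M a (CondC-antimono K M≤N (nonsingular⇒CondC K N a ns)))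
      (λ ns≤N → ns≤N N 1≤N ≤-refl)
  , mk⇔ (nonsingular⇒CondC K N a) (CondC⇒nonsingular K 2≉0 N a)
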